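{- Let $r\geq1$ and let $G$ be an extraspecial $2$-group of order $2^{2r+1}$ with centre $Z=\langle z\rangle$, and suppose $\{Zg_1,\ldots,Zg_{2r}\}$ (with $g_i\in G$) is a symmetric basis of $G/Z$ with respect to the quadratic form $Q(Zx)=x^2$. Then for every $\sigma\in S_{2r}$ there is an automorphism $\tilde\sigma$ of $G$ with $z^{\tilde\sigma}=z$ and $g_i^{\tilde\sigma}=g_{i^\sigma}$ for all $i$, and $\sigma\mapsto\tilde\sigma$ is an injective homomorphism $S_{2r}\to\mathrm{Aut}(G)$; in particular $S_{2r}\leq\mathrm{Aut}(G)$.
   Context: An extraspecial $2$-group of order $2^{2r+1}$ is a $2$-group $G$ with $|Z(G)|=2$ and $G/Z(G)\cong\mathbb{Z}_2^{2r}$. Identifying $Z$ with $\mathbb{F}_2$, $Q(Zx)=x^2$ is a quadratic form on $G/Z$ with associated bilinear form $B(Zx,Zy)=[x,y]$. A basis $\{v_1,\ldots,v_d\}$ is symmetric if $Q(v_i)=0$ for all $i$ and $B(v_i,v_j)=1$ for all $i<j$; thus here each $g_i$ is an involution and $[g_i,g_j]=z$ for $i\ne j$. -}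

module Defs where

open import Level using (Level; _⊔_; 0ℓ)
open import Data.Nat using (ℕ; suc; _+_; _*_; _^_)
open import Data.Bool using (Bool; true; false; _xor_)
open import Data.Fin using (Fin; _<_)
open import Data.Fin.Permutation using (Permutation′; _⟨$⟩ʳ_; _∘ₚ_)
open import Data.Vec using (Vec; zipWith; replicate; foldr; map)
open import Data.Product using (Σ; ∃; _×_; _,_)
open import Data.Sum using (_⊎_)
open import Relation.Nullary using (¬_)
open import Relation.Binary.PropositionalEquality using (_≡_; _≢_)
import Relation.Binary.PropositionalEquality as ≡
open import Function.Bundles using (Inverse)
open import Algebra.Bundles using (Group; RawGroup)
open import Algebra.Morphism.Structures using (module GroupMorphisms)

Z₂^ : ℕ → RawGroup 0ℓ 0ℓ
Z₂^ n = record
  { Carrier = Vec Bool n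
  ; _≈_ = _≡_
  ; _∙_ = zipWith _xor_
  ; ε = replicate n false
  ; _⁻¹ = λ v → v
  }

lincomb : ∀ {n d} → Vec Bool d → (Fin d → Vec Bool n) → Vec Bool n
lincomb {n} {d} s v = go s v
  where
  go : ∀ {k} → Vec Bool k → (Fin k → Vec Bool n) → Vec Bool n
  go Vec.[] w = replicate n false
  go (false Vec.∷ s) w = go s (λ i → w (Fin.suc i))
  go (true Vec.∷ s) w = zipWith _xor_ (w Fin.zero) (go s (λ i → w (Fin.suc i)))

IsBasis : ∀ {n d} → (Fin d → Vec Bool n) → Set
IsBasis {n} {d} v =
  (∀ (w : Vec Bool n) → ∃ λ (s : Vec Bool d) → lincomb s v ≡ w)
  × (∀ (s t : Vec Bool d) → lincomb s v ≡ lincomb t v → s ≡ t)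

module _ {c ℓ} (G : Group c ℓ) where
  open Group G

  IsCentral : Carrier → Set (c ⊔ ℓ)
  IsCentral x = ∀ y → x ∙ y ≈ y ∙ x

  HasOrder : ℕ → Set (c ⊔ ℓ)
  HasOrder N = Inverse (≡.setoid (Fin N)) setoid

  [_,_] : Carrier → Carrier → Carrier
  [ x , y ] = ((x ⁻¹ ∙ y ⁻¹) ∙ x) ∙ y

  Automorphism : Set (c ⊔ ℓ)
  Automorphism = Σ (Carrier → Carrier) (GroupMorphisms.IsGroupIsomorphism rawGroup rawGroup)

  -- G is extraspecial of order 2^(2r+1) with centre Z(G) = {1, z} = ⟨z⟩ (so |Z(G)| = 2),
  -- and φ : G → Z₂^(2r) is a surjective homomorphism with kernel Z(G),
  -- i.e. φ induces an isomorphism G/Z ≅ Z₂^(2r).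
  record IsExtraspecial (r : ℕ) (z : Carrier) (φ : Carrier → Vec Bool (2 * r)) : Set (c ⊔ ℓ) where
    field
      order       : HasOrder (2 ^ (2 * r + 1))
      z-central   : IsCentral z
      z≉ε         : ¬ (z ≈ ε)
      centre      : ∀ x → IsCentral x → x ≈ ε ⊎ x ≈ z
      φ-hom       : GroupMorphisms.IsGroupHomomorphism rawGroup (Z₂^ (2 * r)) φ
      φ-surj      : ∀ (w : Vec Bool (2 * r)) → ∃ λ x → φ x ≡ w
      φ-kernel    : ∀ x → φ x ≡ replicate (2 * r) false → IsCentral x
      φ-kernel⁻¹  : ∀ x → IsCentral x → φ x ≡ replicate (2 * r) false

  -- {Zg_1,…,Zg_d} is a symmetric basis of G/Z: (the images of) the Zg_i form a basis,
  -- Q(Zg_i) = g_i² = 1 (0 ∈ F₂), and B(Zg_i,Zg_j) = [g_i,g_j] = z (1 ∈ F₂) for i < j.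
  record IsSymmetricBasis {d : ℕ} (z : Carrier) (φ : Carrier → Vec Bool d)
                          (g : Fin d → Carrier) : Set (c ⊔ ℓ) where
    field
      basis : IsBasis (λ i → φ (g i))
      Q-zero : ∀ i → g i ∙ g i ≈ ε
      B-one  : ∀ i j → i < j → [ g i , g j ] ≈ z

-- Write x ∈ G as g^s·c with g^s = g₁^(s₁)⋯g₂ᵣ^(s₂ᵣ) and c central; the coordinates s ∈ F₂²ʳ
-- and c are unique because the Zgᵢ form a basis. Since the gᵢ are involutions that pairwise
-- anticommute up to z, the product g^s·g^t equals z^κ(s,t)·g^(s+t) for a cocycle κ that does
-- not see which anticommuting involutions are used. The family (g_(iσ))ᵢ is again such a
-- family, so g^s·c ↦ (gσ)^s·c is an endomorphism σ̃. Endomorphisms agreeing on the gᵢ and on z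
-- agree everywhere (every element is a word in the gᵢ times 1 or z); this gives (στ)~ = σ̃τ̃,
-- so (σ⁻¹)~ inverts σ̃. Finally σ ↦ σ̃ is injective because the gᵢ are pairwise distinct:
-- gᵢ = gⱼ for i ≠ j would force gᵢ² = z·gᵢ², i.e. z = 1.
module Submission where

open import Defs
open import Level using (_⊔_)
open import Data.Nat using (ℕ; _*_; _≥_)
open import Data.Bool using (Bool; true; false; not; _∧_; _xor_)
open import Data.Bool.Properties using (xor-same; xor-identityʳ)
open import Data.Vec using (Vec; []; _∷_; zipWith; replicate)
open import Data.Vec.Properties using (zipWith-inverseˡ; zipWith-identityʳ; map-id)
open import Data.Fin using (Fin; zero; suc; _≟_)
open import Data.Fin.Properties using (<-cmp; suc-injective)
open import Data.Fin.Permutation using (Permutation′; _⟨$⟩ʳ_; _∘ₚ_)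
import Data.Fin.Permutation as Perm
open import Data.Product using (Σ; _×_; _,_; proj₁; proj₂)
open import Data.Sum using (inj₁; inj₂)
open import Data.Empty using (⊥-elim)
open import Function using (_∘_)
open import Function.Bundles using (Injection)
open import Function.Properties.Inverse using (Inverse⇒Injection)
open import Relation.Nullary using (yes; no)
open import Relation.Binary.Definitions using (tri<; tri≈; tri>)
open import Relation.Binary.PropositionalEquality using (_≡_; _≢_)
import Relation.Binary.PropositionalEquality as ≡
open import Algebra.Bundles using (Group)
open import Algebra.Morphism.Structures using (module GroupMorphisms)
import Algebra.Morphism.Construct.Composition as Composition
import Algebra.Morphism.Construct.Identity as Identity

xor-selfᵛ : ∀ {n} (v : Vec Bool n) → zipWith _xor_ v v ≡ replicate n false
xor-selfᵛ v = ≡.trans (≡.cong (λ u → zipWith _xor_ u v) (≡.sym (map-id v)))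
                      (zipWith-inverseˡ xor-same v)

unitVector : ∀ {k} → Fin k → Vec Bool k
unitVector {ℕ.suc k} zero = true ∷ replicate k false
unitVector (suc i) = false ∷ unitVector i

parity : ∀ {k} → Vec Bool k → Bool
parity [] = false
parity (b ∷ s) = b xor parity s

-- κ(s,t) = #{i < j : tᵢ = sⱼ = 1} mod 2, the exponent of z in g^s·g^t = z^κ(s,t)·g^(s+t).
cocycle : ∀ {k} → Vec Bool k → Vec Bool k → Bool
cocycle [] [] = false
cocycle (a ∷ s) (b ∷ t) = (b ∧ parity s) xor cocycle s t

module _ {c ℓ} (G : Group c ℓ) where
  open Group G
  open import Relation.Binary.Reasoning.Setoid setoid
  open import Algebra.Properties.Group G using (inverseʳ-unique)

  ε-central : IsCentral G ε
  ε-central y = trans (identityˡ y) (sym (identityʳ y))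

  ∙-central : ∀ {a b} → IsCentral G a → IsCentral G b → IsCentral G (a ∙ b)
  ∙-central {a} {b} ca cb y = begin
    (a ∙ b) ∙ y  ≈⟨ assoc a b y ⟩
    a ∙ (b ∙ y)  ≈⟨ ∙-congˡ (cb y) ⟩
    a ∙ (y ∙ b)  ≈⟨ assoc a y b ⟨
    (a ∙ y) ∙ b  ≈⟨ ∙-congʳ (ca y) ⟩
    (y ∙ a) ∙ b  ≈⟨ assoc y a b ⟩
    y ∙ (a ∙ b)  ∎

  central-pull : ∀ {a} → IsCentral G a → ∀ x y → x ∙ (a ∙ y) ≈ a ∙ (x ∙ y)
  central-pull {a} ca x y = begin
    x ∙ (a ∙ y)  ≈⟨ assoc x a y ⟨
    (x ∙ a) ∙ y  ≈⟨ ∙-congʳ (ca x) ⟨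
    (a ∙ x) ∙ y  ≈⟨ assoc a x y ⟩
    a ∙ (x ∙ y)  ∎

  cancel-involutionʳ : ∀ {x y a} → y ∙ y ≈ ε → x ∙ y ≈ a → x ≈ a ∙ y
  cancel-involutionʳ {x} {y} {a} y²≈ε xy≈a = begin
    x              ≈⟨ identityʳ x ⟨
    x ∙ ε          ≈⟨ ∙-congˡ y²≈ε ⟨
    x ∙ (y ∙ y)    ≈⟨ assoc x y y ⟨
    (x ∙ y) ∙ y    ≈⟨ ∙-congʳ xy≈a ⟩
    a ∙ y          ∎

  involutions-commutator : ∀ {x y a} → x ∙ x ≈ ε → y ∙ y ≈ ε →
                           [_,_] G x y ≈ a → x ∙ y ≈ a ∙ (y ∙ x)
  involutions-commutator {x} {y} {a} x²≈ε y²≈ε [x,y]≈a = begin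
    x ∙ y          ≈⟨ cancel-involutionʳ x²≈ε (cancel-involutionʳ y²≈ε xyxy≈a) ⟩
    (a ∙ y) ∙ x    ≈⟨ assoc a y x ⟩
    a ∙ (y ∙ x)    ∎
    where
    xyxy≈a : ((x ∙ y) ∙ x) ∙ y ≈ a
    xyxy≈a = trans (∙-congʳ (∙-congʳ (∙-cong (inverseʳ-unique x x x²≈ε)
                                               (inverseʳ-unique y y y²≈ε))))
                   [x,y]≈a

module Words {c ℓ} (G : Group c ℓ) (z : Group.Carrier G) (z-central : IsCentral G z)
             (z-involution : Group._≈_ G (Group._∙_ G z z) (Group.ε G)) where
  open Group G
  open import Relation.Binary.Reasoning.Setoid setoid

  z^_ : Bool → Carrier
  z^ false = ε
  z^ true = z

  _^ᵇ_ : Carrier → Bool → Carrier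
  x ^ᵇ false = ε
  x ^ᵇ true = x

  word : ∀ {k} → Vec Bool k → (Fin k → Carrier) → Carrier
  word [] h = ε
  word (false ∷ s) h = word s (h ∘ suc)
  word (true ∷ s) h = h zero ∙ word s (h ∘ suc)

  record IsAnticommuting {k} (h : Fin k → Carrier) : Set (c ⊔ ℓ) where
    field
      involution  : ∀ i → h i ∙ h i ≈ ε
      anticommute : ∀ i j → i ≢ j → h i ∙ h j ≈ z ∙ (h j ∙ h i)

  reindex : ∀ {k m} {h : Fin k → Carrier} → IsAnticommuting h →
            (π : Fin m → Fin k) → (∀ {i j} → π i ≡ π j → i ≡ j) → IsAnticommuting (h ∘ π)
  reindex h-anti π π-injective = record
    { involution = λ i → involution (π i)
    ; anticommute = λ i j i≢j → anticommute (π i) (π j) (i≢j ∘ π-injective)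
    }
    where open IsAnticommuting h-anti

  z^-central : ∀ a → IsCentral G (z^ a)
  z^-central false = ε-central G
  z^-central true = z-central

  z^-xor : ∀ a b → z^ a ∙ z^ b ≈ z^ (a xor b)
  z^-xor false false = identityˡ ε
  z^-xor false true = identityˡ z
  z^-xor true false = identityʳ z
  z^-xor true true = z-involution

  z^-∙-z : ∀ a → z^ a ∙ z ≈ z^ (not a)
  z^-∙-z false = identityˡ z
  z^-∙-z true = z-involution

  ^ᵇ-xor : ∀ {x} → x ∙ x ≈ ε → ∀ a b → x ^ᵇ a ∙ x ^ᵇ b ≈ x ^ᵇ (a xor b)
  ^ᵇ-xor {x} _ false false = identityˡ ε
  ^ᵇ-xor {x} _ false true = identityˡ x
  ^ᵇ-xor {x} _ true false = identityʳ x
  ^ᵇ-xor x²≈ε true true = x²≈ε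

  word-∷ : ∀ {k} a (s : Vec Bool k) h → word (a ∷ s) h ≈ h zero ^ᵇ a ∙ word s (h ∘ suc)
  word-∷ false s h = sym (identityˡ _)
  word-∷ true s h = refl

  word-zeros : ∀ k (h : Fin k → Carrier) → word (replicate k false) h ≡ ε
  word-zeros ℕ.zero h = ≡.refl
  word-zeros (ℕ.suc k) h = word-zeros k (h ∘ suc)

  word-unitVector : ∀ {k} (i : Fin k) h → word (unitVector i) h ≈ h i
  word-unitVector {ℕ.suc k} zero h =
    trans (∙-congˡ (reflexive (word-zeros k (h ∘ suc)))) (identityʳ _)
  word-unitVector (suc i) h = word-unitVector i (h ∘ suc)

  word-∙-anticommuting : ∀ {k x} (h : Fin k → Carrier) → (∀ j → h j ∙ x ≈ z ∙ (x ∙ h j)) →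
                         ∀ s → word s h ∙ x ≈ z^ (parity s) ∙ (x ∙ word s h)
  word-∙-anticommuting {x = x} h anti [] = begin
    ε ∙ x          ≈⟨ identityˡ x ⟩
    x              ≈⟨ identityʳ x ⟨
    x ∙ ε          ≈⟨ identityˡ (x ∙ ε) ⟨
    ε ∙ (x ∙ ε)    ∎
  word-∙-anticommuting h anti (false ∷ s) = word-∙-anticommuting (h ∘ suc) (anti ∘ suc) s
  word-∙-anticommuting {x = x} h anti (true ∷ s) = begin
    (y ∙ w) ∙ x                   ≈⟨ assoc y w x ⟩
    y ∙ (w ∙ x)                   ≈⟨ ∙-congˡ (word-∙-anticommuting (h ∘ suc) (anti ∘ suc) s) ⟩
    y ∙ (z^ p ∙ (x ∙ w))          ≈⟨ central-pull G (z^-central p) y (x ∙ w) ⟩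
    z^ p ∙ (y ∙ (x ∙ w))          ≈⟨ ∙-congˡ (assoc y x w) ⟨
    z^ p ∙ ((y ∙ x) ∙ w)          ≈⟨ ∙-congˡ (∙-congʳ (anti zero)) ⟩
    z^ p ∙ ((z ∙ (x ∙ y)) ∙ w)    ≈⟨ ∙-congˡ (assoc z (x ∙ y) w) ⟩
    z^ p ∙ (z ∙ ((x ∙ y) ∙ w))    ≈⟨ assoc (z^ p) z ((x ∙ y) ∙ w) ⟨
    (z^ p ∙ z) ∙ ((x ∙ y) ∙ w)    ≈⟨ ∙-cong (z^-∙-z p) (assoc x y w) ⟩
    z^ (not p) ∙ (x ∙ (y ∙ w))    ∎
    where
    y = h zero
    w = word s (h ∘ suc)
    p = parity s

  word-∙-^ᵇ : ∀ {k x} (h : Fin k → Carrier) → (∀ j → h j ∙ x ≈ z ∙ (x ∙ h j)) →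
              ∀ b s → word s h ∙ x ^ᵇ b ≈ z^ (b ∧ parity s) ∙ (x ^ᵇ b ∙ word s h)
  word-∙-^ᵇ h anti false s = trans (identityʳ _) (sym (trans (identityˡ _) (identityˡ _)))
  word-∙-^ᵇ h anti true s = word-∙-anticommuting h anti s

  word-∙ : ∀ {k} {h : Fin k → Carrier} → IsAnticommuting h → ∀ s t →
           word s h ∙ word t h ≈ z^ (cocycle s t) ∙ word (zipWith _xor_ s t) h
  word-∙ h-anti [] [] = refl
  word-∙ {h = h} h-anti (a ∷ s) (b ∷ t) = begin
    word (a ∷ s) h ∙ word (b ∷ t) h     ≈⟨ ∙-cong (word-∷ a s h) (word-∷ b t h) ⟩
    (y ^ᵇ a ∙ u) ∙ (y ^ᵇ b ∙ v)         ≈⟨ assoc (y ^ᵇ a) u (y ^ᵇ b ∙ v) ⟩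
    y ^ᵇ a ∙ (u ∙ (y ^ᵇ b ∙ v))         ≈⟨ ∙-congˡ (assoc u (y ^ᵇ b) v) ⟨
    y ^ᵇ a ∙ ((u ∙ y ^ᵇ b) ∙ v)         ≈⟨ ∙-congˡ (∙-congʳ (word-∙-^ᵇ (h ∘ suc) anti-y b s)) ⟩
    y ^ᵇ a ∙ ((z^ q ∙ (y ^ᵇ b ∙ u)) ∙ v) ≈⟨ ∙-congˡ (assoc (z^ q) (y ^ᵇ b ∙ u) v) ⟩
    y ^ᵇ a ∙ (z^ q ∙ ((y ^ᵇ b ∙ u) ∙ v)) ≈⟨ central-pull G (z^-central q) _ _ ⟩
    z^ q ∙ (y ^ᵇ a ∙ ((y ^ᵇ b ∙ u) ∙ v)) ≈⟨ ∙-congˡ (∙-congˡ (assoc (y ^ᵇ b) u v)) ⟩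
    z^ q ∙ (y ^ᵇ a ∙ (y ^ᵇ b ∙ (u ∙ v))) ≈⟨ ∙-congˡ (assoc (y ^ᵇ a) (y ^ᵇ b) (u ∙ v)) ⟨
    z^ q ∙ ((y ^ᵇ a ∙ y ^ᵇ b) ∙ (u ∙ v)) ≈⟨ ∙-congˡ (∙-cong (^ᵇ-xor (involution zero) a b)
                                                            (word-∙ tail-anti s t)) ⟩
    z^ q ∙ (y ^ᵇ (a xor b) ∙ (z^ κ ∙ w)) ≈⟨ ∙-congˡ (central-pull G (z^-central κ) _ w) ⟩
    z^ q ∙ (z^ κ ∙ (y ^ᵇ (a xor b) ∙ w)) ≈⟨ assoc (z^ q) (z^ κ) _ ⟨
    (z^ q ∙ z^ κ) ∙ (y ^ᵇ (a xor b) ∙ w) ≈⟨ ∙-cong (z^-xor q κ) (sym (word-∷ (a xor b) _ h)) ⟩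
    z^ (q xor κ) ∙ word (zipWith _xor_ (a ∷ s) (b ∷ t)) h ∎
    where
    open IsAnticommuting h-anti
    tail-anti = reindex h-anti suc suc-injective
    anti-y : ∀ j → h (suc j) ∙ h zero ≈ z ∙ (h zero ∙ h (suc j))
    anti-y j = anticommute (suc j) zero (λ ())
    y = h zero
    u = word s (h ∘ suc)
    v = word t (h ∘ suc)
    w = word (zipWith _xor_ s t) (h ∘ suc)
    q = b ∧ parity s
    κ = cocycle s t

  word-∙-central : ∀ {k} {h : Fin k → Carrier} → IsAnticommuting h → ∀ s t {C D} →
                   IsCentral G C →
                   (word s h ∙ C) ∙ (word t h ∙ D)
                     ≈ word (zipWith _xor_ s t) h ∙ (z^ (cocycle s t) ∙ (C ∙ D))
  word-∙-central {h = h} h-anti s t {C} {D} C-central = begin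
    (u ∙ C) ∙ (v ∙ D)     ≈⟨ assoc u C (v ∙ D) ⟩
    u ∙ (C ∙ (v ∙ D))     ≈⟨ ∙-congˡ (central-pull G C-central v D) ⟨
    u ∙ (v ∙ (C ∙ D))     ≈⟨ assoc u v (C ∙ D) ⟨
    (u ∙ v) ∙ (C ∙ D)     ≈⟨ ∙-congʳ (word-∙ h-anti s t) ⟩
    (z^ κ ∙ w) ∙ (C ∙ D)  ≈⟨ ∙-congʳ (z^-central κ w) ⟩
    (w ∙ z^ κ) ∙ (C ∙ D)  ≈⟨ assoc w (z^ κ) (C ∙ D) ⟩
    w ∙ (z^ κ ∙ (C ∙ D))  ∎
    where
    u = word s h
    v = word t h
    w = word (zipWith _xor_ s t) h
    κ = cocycle s t

module Extraspecial {c ℓ} (G : Group c ℓ) (r : ℕ) (z : Group.Carrier G)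
                    (φ : Group.Carrier G → Vec Bool (2 * r)) (E : IsExtraspecial G r z φ)
                    (g : Fin (2 * r) → Group.Carrier G) (S : IsSymmetricBasis G z φ g) where
  open Group G
  open import Relation.Binary.Reasoning.Setoid setoid
  open import Algebra.Properties.Group G using (inverseʳ-unique; identityˡ-unique)
  open IsExtraspecial E
  open IsSymmetricBasis S
  module φ = GroupMorphisms.IsGroupHomomorphism φ-hom
  open GroupMorphisms rawGroup rawGroup
    using (IsGroupHomomorphism; IsGroupIsomorphism)

  z-involution : z ∙ z ≈ ε
  z-involution with centre (z ∙ z) (∙-central G z-central z-central)
  ... | inj₁ z²≈ε = z²≈ε
  ... | inj₂ z²≈z = ⊥-elim (z≉ε (identityˡ-unique z z z²≈z))

  open Words G z z-central z-involution

  g-anticommuting : IsAnticommuting g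
  g-anticommuting = record { involution = Q-zero ; anticommute = anticommute }
    where
    swap-z : ∀ {a b} → a ≈ z ∙ b → b ≈ z ∙ a
    swap-z {a} {b} a≈zb = sym (begin
      z ∙ a          ≈⟨ ∙-congˡ a≈zb ⟩
      z ∙ (z ∙ b)    ≈⟨ assoc z z b ⟨
      (z ∙ z) ∙ b    ≈⟨ ∙-congʳ z-involution ⟩
      ε ∙ b          ≈⟨ identityˡ b ⟩
      b              ∎)
    anticommute : ∀ i j → i ≢ j → g i ∙ g j ≈ z ∙ (g j ∙ g i)
    anticommute i j i≢j with <-cmp i j
    ... | tri< i<j _ _ = involutions-commutator G (Q-zero i) (Q-zero j) (B-one i j i<j)
    ... | tri≈ _ i≡j _ = ⊥-elim (i≢j i≡j)
    ... | tri> _ _ j<i = swap-z (involutions-commutator G (Q-zero j) (Q-zero i) (B-one j i j<i))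

  g-injective : ∀ {i j} → g i ≈ g j → i ≡ j
  g-injective {i} {j} gᵢ≈gⱼ with i ≟ j
  ... | yes i≡j = i≡j
  ... | no i≢j = ⊥-elim (z≉ε (sym (begin
    ε                    ≈⟨ Q-zero i ⟨
    g i ∙ g i            ≈⟨ ∙-congˡ gᵢ≈gⱼ ⟩
    g i ∙ g j            ≈⟨ IsAnticommuting.anticommute g-anticommuting i j i≢j ⟩
    z ∙ (g j ∙ g i)      ≈⟨ ∙-congˡ (∙-congʳ gᵢ≈gⱼ) ⟨
    z ∙ (g i ∙ g i)      ≈⟨ ∙-congˡ (Q-zero i) ⟩
    z ∙ ε                ≈⟨ identityʳ z ⟩
    z                    ∎)))

  φ-word : ∀ {k} s (h : Fin k → Carrier) → φ (word s h) ≡ lincomb s (φ ∘ h)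
  φ-word [] h = φ.ε-homo
  φ-word (false ∷ s) h = φ-word s (h ∘ suc)
  φ-word (true ∷ s) h =
    ≡.trans (φ.homo _ _) (≡.cong (zipWith _xor_ (φ (h zero))) (φ-word s (h ∘ suc)))

  coordinates : Carrier → Vec Bool (2 * r)
  coordinates x = proj₁ (proj₁ basis (φ x))

  φ-word-coordinates : ∀ x → φ (word (coordinates x) g) ≡ φ x
  φ-word-coordinates x = ≡.trans (φ-word (coordinates x) g) (proj₂ (proj₁ basis (φ x)))

  centralPart : Carrier → Carrier
  centralPart x = word (coordinates x) g ⁻¹ ∙ x

  centralPart-central : ∀ x → IsCentral G (centralPart x)
  centralPart-central x = φ-kernel (centralPart x)
    (≡.trans (φ.homo _ x)
    (≡.trans (≡.cong (λ v → zipWith _xor_ v (φ x)) (≡.trans (φ.⁻¹-homo _) (φ-word-coordinates x)))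
             (xor-selfᵛ (φ x))))

  normalForm : ∀ x → x ≈ word (coordinates x) g ∙ centralPart x
  normalForm x = begin
    x              ≈⟨ identityˡ x ⟨
    ε ∙ x          ≈⟨ ∙-congʳ (inverseʳ w) ⟨
    (w ∙ w ⁻¹) ∙ x ≈⟨ assoc w (w ⁻¹) x ⟩
    w ∙ (w ⁻¹ ∙ x) ∎
    where w = word (coordinates x) g

  normalForm-unique : ∀ x t C → x ≈ word t g ∙ C → IsCentral G C →
                      t ≡ coordinates x × centralPart x ≈ C
  normalForm-unique x t C x≈g^tC C-central = t≡coords , centralPart≈C
    where
    φx≡φg^t : φ x ≡ φ (word t g)
    φx≡φg^t = ≡.trans (φ.⟦⟧-cong x≈g^tC) (≡.trans (φ.homo _ C)
      (≡.trans (≡.cong (zipWith _xor_ _) (φ-kernel⁻¹ C C-central))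
               (zipWith-identityʳ xor-identityʳ _)))
    t≡coords : t ≡ coordinates x
    t≡coords = proj₂ basis t (coordinates x) (≡.trans (≡.sym (φ-word t g))
      (≡.trans (≡.sym φx≡φg^t) (≡.sym (proj₂ (proj₁ basis (φ x))))))
    w = word t g
    centralPart≈C : centralPart x ≈ C
    centralPart≈C = begin
      word (coordinates x) g ⁻¹ ∙ x ≈⟨ ∙-congʳ (⁻¹-cong (reflexive (≡.cong (λ s → word s g) t≡coords))) ⟨
      w ⁻¹ ∙ x                      ≈⟨ ∙-congˡ x≈g^tC ⟩
      w ⁻¹ ∙ (w ∙ C)                ≈⟨ assoc (w ⁻¹) w C ⟨
      (w ⁻¹ ∙ w) ∙ C                ≈⟨ ∙-congʳ (inverseˡ w) ⟩
      ε ∙ C                         ≈⟨ identityˡ C ⟩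
      C                             ∎

  homomorphism-ext : ∀ {c′ ℓ′} (H : Group c′ ℓ′) {f f′ : Carrier → Group.Carrier H} →
    GroupMorphisms.IsGroupHomomorphism rawGroup (Group.rawGroup H) f →
    GroupMorphisms.IsGroupHomomorphism rawGroup (Group.rawGroup H) f′ →
    (∀ i → Group._≈_ H (f (g i)) (f′ (g i))) → Group._≈_ H (f z) (f′ z) →
    ∀ x → Group._≈_ H (f x) (f′ x)
  homomorphism-ext H {f} {f′} f-hom f′-hom f≈f′-on-g f≈f′-on-z x =
    H.trans (F.⟦⟧-cong (normalForm x))
    (H.trans (F.homo _ _)
    (H.trans (H.∙-cong (on-words (coordinates x) g f≈f′-on-g) (on-central (centralPart-central x)))
    (H.trans (H.sym (F′.homo _ _))
             (H.sym (F′.⟦⟧-cong (normalForm x))))))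
    where
    module H = Group H
    module F = GroupMorphisms.IsGroupHomomorphism f-hom
    module F′ = GroupMorphisms.IsGroupHomomorphism f′-hom
    on-ε : f ε H.≈ f′ ε
    on-ε = H.trans F.ε-homo (H.sym F′.ε-homo)
    on-words : ∀ {k} s (h : Fin k → Carrier) → (∀ i → f (h i) H.≈ f′ (h i)) →
               f (word s h) H.≈ f′ (word s h)
    on-words [] h _ = on-ε
    on-words (false ∷ s) h on-h = on-words s (h ∘ suc) (on-h ∘ suc)
    on-words (true ∷ s) h on-h = H.trans (F.homo _ _)
      (H.trans (H.∙-cong (on-h zero) (on-words s (h ∘ suc) (on-h ∘ suc))) (H.sym (F′.homo _ _)))
    on-central : ∀ {y} → IsCentral G y → f y H.≈ f′ y
    on-central {y} y-central with centre y y-central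
    ... | inj₁ y≈ε = H.trans (F.⟦⟧-cong y≈ε) (H.trans on-ε (H.sym (F′.⟦⟧-cong y≈ε)))
    ... | inj₂ y≈z = H.trans (F.⟦⟧-cong y≈z) (H.trans f≈f′-on-z (H.sym (F′.⟦⟧-cong y≈z)))

  permuted : Permutation′ (2 * r) → Fin (2 * r) → Carrier
  permuted σ i = g (σ ⟨$⟩ʳ i)

  permuted-anticommuting : ∀ σ → IsAnticommuting (permuted σ)
  permuted-anticommuting σ =
    reindex g-anticommuting (σ ⟨$⟩ʳ_) (Injection.injective (Inverse⇒Injection σ))

  lift : Permutation′ (2 * r) → Carrier → Carrier
  lift σ x = word (coordinates x) (permuted σ) ∙ centralPart x

  lift-normalForm : ∀ σ {x} t {C} → x ≈ word t g ∙ C → IsCentral G C →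
                    lift σ x ≈ word t (permuted σ) ∙ C
  lift-normalForm σ {x} t {C} x≈g^tC C-central with normalForm-unique x t C x≈g^tC C-central
  ... | t≡coords , centralPart≈C =
    ∙-cong (reflexive (≡.cong (λ s → word s (permuted σ)) (≡.sym t≡coords))) centralPart≈C

  lift-cong : ∀ σ {x y} → x ≈ y → lift σ x ≈ lift σ y
  lift-cong σ {x} {y} x≈y = sym (lift-normalForm σ (coordinates x)
    (trans (sym x≈y) (normalForm x)) (centralPart-central x))

  lift-∙ : ∀ σ x y → lift σ (x ∙ y) ≈ lift σ x ∙ lift σ y
  lift-∙ σ x y = trans
    (lift-normalForm σ (zipWith _xor_ s t) (trans (∙-cong (normalForm x) (normalForm y))
                                (word-∙-central g-anticommuting s t cx-central))
                         (∙-central G (z^-central (cocycle s t))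
                                      (∙-central G cx-central (centralPart-central y))))
    (sym (word-∙-central (permuted-anticommuting σ) s t cx-central))
    where
    s = coordinates x
    t = coordinates y
    cx-central = centralPart-central x

  lift-ε : ∀ σ → lift σ ε ≈ ε
  lift-ε σ = trans
    (lift-normalForm σ (replicate (2 * r) false)
      (sym (trans (identityʳ _) (reflexive (word-zeros (2 * r) g)))) (ε-central G))
    (trans (identityʳ _) (reflexive (word-zeros (2 * r) (permuted σ))))

  lift-z : ∀ σ → lift σ z ≈ z
  lift-z σ = trans
    (lift-normalForm σ (replicate (2 * r) false)
      (sym (trans (∙-congʳ (reflexive (word-zeros (2 * r) g))) (identityˡ z))) z-central)
    (trans (∙-congʳ (reflexive (word-zeros (2 * r) (permuted σ)))) (identityˡ z))

  lift-g : ∀ σ i → lift σ (g i) ≈ g (σ ⟨$⟩ʳ i)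
  lift-g σ i = trans
    (lift-normalForm σ (unitVector i)
      (sym (trans (identityʳ _) (word-unitVector i g))) (ε-central G))
    (trans (identityʳ _) (word-unitVector i (permuted σ)))

  lift-isGroupHomomorphism : ∀ σ → IsGroupHomomorphism (lift σ)
  lift-isGroupHomomorphism σ = record
    { isMonoidHomomorphism = record
      { isMagmaHomomorphism = record
        { isRelHomomorphism = record { cong = lift-cong σ }
        ; homo = lift-∙ σ
        }
      ; ε-homo = lift-ε σ
      }
    ; ⁻¹-homo = λ x → inverseʳ-unique (lift σ x) (lift σ (x ⁻¹))
        (trans (sym (lift-∙ σ x (x ⁻¹))) (trans (lift-cong σ (inverseʳ x)) (lift-ε σ)))
    }

  lift-∘ : ∀ σ τ x → lift (σ ∘ₚ τ) x ≈ lift τ (lift σ x)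
  lift-∘ σ τ = homomorphism-ext G (lift-isGroupHomomorphism (σ ∘ₚ τ))
    (Composition.isGroupHomomorphism trans (lift-isGroupHomomorphism σ) (lift-isGroupHomomorphism τ))
    (λ i → trans (lift-g (σ ∘ₚ τ) i) (sym (trans (lift-cong τ (lift-g σ i)) (lift-g τ _))))
    (trans (lift-z (σ ∘ₚ τ)) (sym (trans (lift-cong τ (lift-z σ)) (lift-z τ))))

  lift-identity : ∀ ρ → (∀ i → ρ ⟨$⟩ʳ i ≡ i) → ∀ x → lift ρ x ≈ x
  lift-identity ρ ρ≗id = homomorphism-ext G (lift-isGroupHomomorphism ρ)
    (Identity.isGroupHomomorphism rawGroup refl)
    (λ i → trans (lift-g ρ i) (reflexive (≡.cong g (ρ≗id i)))) (lift-z ρ)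

  lift-inverse : ∀ σ x → lift (Perm.flip σ) (lift σ x) ≈ x
  lift-inverse σ x = trans (sym (lift-∘ σ (Perm.flip σ) x))
                           (lift-identity (σ ∘ₚ Perm.flip σ) (λ _ → Perm.inverseˡ σ) x)

  lift-isGroupIsomorphism : ∀ σ → IsGroupIsomorphism (lift σ)
  lift-isGroupIsomorphism σ = record
    { isGroupMonomorphism = record
      { isGroupHomomorphism = lift-isGroupHomomorphism σ
      ; injective = λ {x} {y} σ̃x≈σ̃y →
          trans (sym (lift-inverse σ x)) (trans (lift-cong (Perm.flip σ) σ̃x≈σ̃y) (lift-inverse σ y))
      }
    ; surjective = λ y → lift (Perm.flip σ) y ,
        λ w≈σ⁻¹y → trans (lift-cong σ w≈σ⁻¹y) (lift-inverse (Perm.flip σ) y)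
    }

  lift-faithful : ∀ σ τ → (∀ x → lift σ x ≈ lift τ x) → ∀ i → σ ⟨$⟩ʳ i ≡ τ ⟨$⟩ʳ i
  lift-faithful σ τ σ̃≈τ̃ i =
    g-injective (trans (sym (lift-g σ i)) (trans (σ̃≈τ̃ (g i)) (lift-g τ i)))

theorem4p1 : ∀ {c ℓ} (G : Group c ℓ) (r : ℕ) → r ≥ 1 →
    (z : Group.Carrier G) (φ : Group.Carrier G → Vec Bool (2 * r)) →
    IsExtraspecial G r z φ →
    (g : Fin (2 * r) → Group.Carrier G) → IsSymmetricBasis G z φ g →
    Σ (Permutation′ (2 * r) → Automorphism G) λ lift →
      -- each σ̃ fixes z and sends g_i to g_(i^σ)
      ((σ : Permutation′ (2 * r)) →
        Group._≈_ G (proj₁ (lift σ) z) z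
        × (∀ i → Group._≈_ G (proj₁ (lift σ) (g i)) (g (σ ⟨$⟩ʳ i))))
      -- homomorphism (right actions): x^(στ) = (x^σ)^τ, where i^(στ) = (i^σ)^τ
      × (∀ (σ τ : Permutation′ (2 * r)) (x : Group.Carrier G) →
          Group._≈_ G (proj₁ (lift (σ ∘ₚ τ)) x) (proj₁ (lift τ) (proj₁ (lift σ) x)))
      -- injective: equal automorphisms come from equal permutations
      × (∀ (σ τ : Permutation′ (2 * r)) →
          (∀ x → Group._≈_ G (proj₁ (lift σ) x) (proj₁ (lift τ) x)) →
          ∀ i → σ ⟨$⟩ʳ i ≡ τ ⟨$⟩ʳ i)
theorem4p1 G r _ z φ E g S =
  (λ σ → lift σ , lift-isGroupIsomorphism σ) , (λ σ → lift-z σ , lift-g σ) , lift-∘ , lift-faithful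
  where open Extraspecial G r z φ E g S
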